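{- Let $G$ be a parity game and $\mathcal M=(M,<,\bot,\top,\upharpoonright,+)$ a regress measure space with canonical truncation operator satisfying $\bot\upharpoonright_v=\bot$ for every position $v$ of odd priority. Let $\mu:V\to M$ be a simple quasi-dominion measure (i.e. both a simple measure function and a quasi-dominion measure). Then $D_+(\mu)$ is a quasi 0-dominion, and every $\mu$-coherent 0-strategy that is winning on $D_0(\mu)$ is, once restricted to $D_+(\mu)$, a 0-witness for it.
   Context: Parity game: finite disjoint $V_0,V_1$ (positions of players 0,1), $V=V_0\cup V_1$, move relation $E\subseteq V\times V$ with $E(v)=\{w:(v,w)\in E\}\neq\emptyset$ for all $v$, priority function $p:V\to P$, $P\subset\mathbb{N}$ finite. A positional $\alpha$-strategy on $U\subseteq V$ is $\sigma:U\cap V_\alpha\to V$ with $(v,\sigma(v))\in E$ (restriction to $U$ restricts its domain to $U\cap V_\alpha$). For strategies $\sigma_0,\sigma_1$ on $U$ and $v\in U$, the play from $v$ in $U$ is the maximal finite or infinite sequence of positions of $U$ starting at $v$ whose successor at a $V_\alpha$ position is given by $\sigma_\alpha$ (it stops when the prescribed successor lies outside $U$). The priority of a finite nonempty path is its maximal priority; of an infinite play, the maximal priority occurring infinitely often. $U$ is a 0-dominion if some 0-strategy on $U$ ensures that for every 1-strategy on $U$ and $v\in U$ the play is infinite with even priority; a 0-strategy is winning on $U$ if its restriction to $U$ is such. $Q$ is a quasi 0-dominion if there is a 0-strategy on $Q$ (a 0-witness) such that for every 1-strategy on $Q$ and every $v\in Q$, the induced play in $Q$ (finite or infinite) has even priority.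 Measure space $(M,<,\bot,\top,\upharpoonright,+)$: $<$ strict total order on $M$ with min $\bot$, max $\top$; truncation $\upharpoonright:M\times V\to M$; stretch $+:M\times V\to M$. Truncation canonical: $\eta=\top$ iff $\eta\upharpoonright_v=\top$, and monotone in $\eta$. Regress measure space: (1) $(\eta+v)\upharpoonright_v<\eta\upharpoonright_v$ if $\bot<\eta\upharpoonright_v<\top$ and $p(v)$ odd; (2) $(\eta+v)\upharpoonright_u\le\eta\upharpoonright_u$ for all odd-priority $u$ with $p(v)\le p(u)$. For $\mu:V\to M$: $D_0(\mu)=\{v:\mu(v)\upharpoonright_v=\top\}$, $D_\bot(\mu)=\{v:\mu(v)\upharpoonright_v=\bot\}$, $D_+(\mu)=V\setminus D_\bot(\mu)$. Regress measure: for all $v\in D_+(\mu)\setminus D_0(\mu)$, if $v\in V_0$ then $\mu(v)\le\mu(w)+v$ for some $w\in E(v)$, if $v\in V_1$ then for all $w\in E(v)$. Quasi-dominion measure: regress measure with $D_0(\mu)$ a 0-dominion. Measure of a finite path: $\mathrm{msr}(\varepsilon)=\bot$, $\mathrm{msr}(v\cdot\pi')=\mathrm{msr}(\pi')+v$; $S(v,X)=\{\mathrm{msr}(\pi):\pi$ finite simple path from $v$ with all positions in $X$, empty path included$\}\cup\{\top\}$; simple measure function: $\mu(v)\in S(v,D_+(\mu))$ for all $v$. A 0-strategy $\sigma$ is $\mu$-coherent if $\mu(v)\le\mu(\sigma(v))+v$ for all $v\in V_0$. -}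

module Defs where

open import Level using (0ℓ)
open import Data.Nat using (ℕ; zero; suc; _≤_; _<_; _⊔_)
open import Data.Nat.Divisibility using (_∣_)
open import Data.Fin using (Fin)
open import Data.List using (List; []; _∷_)
open import Data.List.Relation.Unary.All using (All)
open import Data.List.Relation.Unary.Unique.Propositional using (Unique)
open import Data.Product using (Σ; Σ-syntax; ∃; ∃-syntax; _×_; _,_; proj₁)
open import Data.Sum using (_⊎_)
open import Data.Unit using (⊤)
open import Data.Empty renaming (⊥ to ⊥₀)
open import Relation.Nullary using (¬_)
open import Relation.Binary.PropositionalEquality using (_≡_)
open import Relation.Binary.Structures using (IsStrictTotalOrder)

Even : ℕ → Set
Even q = 2 ∣ q

Odd : ℕ → Set
Odd q = ¬ Even q

data Player : Set where
  P0 P1 : Player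

record Game : Set₁ where
  field
    n     : ℕ
    owner : Fin n → Player
    E     : Fin n → Fin n → Set
    total : ∀ v → ∃[ w ] E v w
    prio  : Fin n → ℕ

module _ (G : Game) where
  open Game G

  Pos : Set
  Pos = Fin n

  Region : Set₁
  Region = Pos → Set

  Strategy : Player → Region → Set
  Strategy α U = (v : Pos) → U v → owner v ≡ α → Σ[ w ∈ Pos ] E v w

  GStrategy : Player → Set
  GStrategy α = (v : Pos) → owner v ≡ α → Σ[ w ∈ Pos ] E v w

  restrict : ∀ {α} (U : Region) → GStrategy α → Strategy α U
  restrict U σ v _ o = σ v o

  Prescribed : (U : Region) → Strategy P0 U → Strategy P1 U → Pos → Pos → Set
  Prescribed U σ₀ σ₁ v w =
    (∀ (h : U v) (o : owner v ≡ P0) → proj₁ (σ₀ v h o) ≡ w) ×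
    (∀ (h : U v) (o : owner v ≡ P1) → proj₁ (σ₁ v h o) ≡ w)

  prioUpTo : (ℕ → Pos) → ℕ → ℕ
  prioUpTo π zero    = prio (π zero)
  prioUpTo π (suc k) = prioUpTo π k ⊔ prio (π (suc k))

  record FinitePlay (U : Region) (σ₀ : Strategy P0 U) (σ₁ : Strategy P1 U) (v : Pos) : Set where
    field
      len   : ℕ
      pos   : ℕ → Pos
      start : pos zero ≡ v
      inU   : ∀ i → i ≤ len → U (pos i)
      steps : ∀ i → i < len → Prescribed U σ₀ σ₁ (pos i) (pos (suc i))
      stops : ∃[ w ] (Prescribed U σ₀ σ₁ (pos len) w × ¬ U w)

  record InfinitePlay (U : Region) (σ₀ : Strategy P0 U) (σ₁ : Strategy P1 U) (v : Pos) : Set where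
    field
      pos   : ℕ → Pos
      start : pos zero ≡ v
      inU   : ∀ i → U (pos i)
      steps : ∀ i → Prescribed U σ₀ σ₁ (pos i) (pos (suc i))

  FinPrio : ∀ {U σ₀ σ₁ v} → FinitePlay U σ₀ σ₁ v → ℕ
  FinPrio π = prioUpTo (FinitePlay.pos π) (FinitePlay.len π)

  InfOften : (ℕ → Pos) → ℕ → Set
  InfOften π q = ∀ i → ∃[ j ] (i ≤ j × prio (π j) ≡ q)

  IsInfPrio : (ℕ → Pos) → ℕ → Set
  IsInfPrio π q = InfOften π q × (∀ q' → InfOften π q' → q' ≤ q)

  InfEven : ∀ {U σ₀ σ₁ v} → InfinitePlay U σ₀ σ₁ v → Set
  InfEven π = ∃[ q ] (IsInfPrio (InfinitePlay.pos π) q × Even q)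

  Ensures : (U : Region) → Strategy P0 U → Set
  Ensures U σ₀ = ∀ (σ₁ : Strategy P1 U) (v : Pos) → U v →
    (¬ FinitePlay U σ₀ σ₁ v) × (∀ (π : InfinitePlay U σ₀ σ₁ v) → InfEven π)

  Dominion0 : Region → Set
  Dominion0 U = Σ[ σ₀ ∈ Strategy P0 U ] Ensures U σ₀

  WinningOn : Region → GStrategy P0 → Set
  WinningOn U σ = Ensures U (restrict U σ)

  QuasiWitness : (Q : Region) → Strategy P0 Q → Set
  QuasiWitness Q σ₀ = ∀ (σ₁ : Strategy P1 Q) (v : Pos) → Q v →
    (∀ (π : FinitePlay Q σ₀ σ₁ v) → Even (FinPrio π)) ×
    (∀ (π : InfinitePlay Q σ₀ σ₁ v) → InfEven π)

  QuasiDominion0 : Region → Set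
  QuasiDominion0 Q = Σ[ σ₀ ∈ Strategy P0 Q ] QuasiWitness Q σ₀

  record MeasureSpace : Set₁ where
    field
      M      : Set
      _<ᴹ_   : M → M → Set
      isSTO  : IsStrictTotalOrder _≡_ _<ᴹ_
      bot    : M
      top    : M
      _↾_    : M → Pos → M
      _⊕_    : M → Pos → M
    _≤ᴹ_ : M → M → Set
    η ≤ᴹ η' = η <ᴹ η' ⊎ η ≡ η'
    field
      bot-min : ∀ η → bot ≤ᴹ η
      top-max : ∀ η → η ≤ᴹ top

  module _ (𝓜 : MeasureSpace) where
    open MeasureSpace 𝓜

    CanonicalTruncation : Set
    CanonicalTruncation =
      (∀ η v → (η ≡ top → η ↾ v ≡ top) × (η ↾ v ≡ top → η ≡ top)) ×
      (∀ η η' v → η ≤ᴹ η' → (η ↾ v) ≤ᴹ (η' ↾ v))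

    RegressSpace : Set
    RegressSpace =
      (∀ η v → bot <ᴹ (η ↾ v) → (η ↾ v) <ᴹ top → Odd (prio v) →
         ((η ⊕ v) ↾ v) <ᴹ (η ↾ v)) ×
      (∀ η v u → Odd (prio u) → prio v ≤ prio u → ((η ⊕ v) ↾ u) ≤ᴹ (η ↾ u))

    D0 : (Pos → M) → Region
    D0 μ v = μ v ↾ v ≡ top

    Dbot : (Pos → M) → Region
    Dbot μ v = μ v ↾ v ≡ bot

    Dplus : (Pos → M) → Region
    Dplus μ v = ¬ Dbot μ v

    RegressMeasure : (Pos → M) → Set
    RegressMeasure μ = ∀ v → Dplus μ v → ¬ D0 μ v →
      (owner v ≡ P0 → ∃[ w ] (E v w × μ v ≤ᴹ (μ w ⊕ v))) ×
      (owner v ≡ P1 → ∀ w → E v w → μ v ≤ᴹ (μ w ⊕ v))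

    QuasiDominionMeasure : (Pos → M) → Set
    QuasiDominionMeasure μ = RegressMeasure μ × Dominion0 (D0 μ)

    msr : List Pos → M
    msr []      = bot
    msr (v ∷ π) = msr π ⊕ v

    IsPath : List Pos → Set
    IsPath []           = ⊤
    IsPath (x ∷ [])     = ⊤
    IsPath (x ∷ y ∷ π)  = E x y × IsPath (y ∷ π)

    StartsAt : Pos → List Pos → Set
    StartsAt v []      = ⊤
    StartsAt v (x ∷ _) = x ≡ v

    InS : Pos → Region → M → Set
    InS v X η = η ≡ top ⊎
      Σ[ π ∈ List Pos ] (StartsAt v π × IsPath π × Unique π × All X π × msr π ≡ η)

    SimpleMeasure : (Pos → M) → Set
    SimpleMeasure μ = ∀ v → InS v (Dplus μ) (μ v)

    Coherent : (Pos → M) → GStrategy P0 → Set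
    Coherent μ σ = ∀ v (o : owner v ≡ P0) → μ v ≤ᴹ (μ (proj₁ (σ v o)) ⊕ v)

-- Along a prescribed move from x ∈ D₊ ∖ D₀ the measure regresses, μ x ≤ μ y + x, so truncated at
-- any odd u with p(x) ≤ p(u) it does not decrease along the play. A finite play leaving D₊ never
-- meets D₀ (σ wins there, and a position of D₀ outside D₊ forces ⊤ = ⊥), so truncating at its
-- odd top-priority position u it would climb from μ(u)↾u > ⊥ up to μ(w)↾u at the exit w; but
-- μ(w) = ⊥ as μ is simple and w ∉ D₊, and ⊥↾u = ⊥. An infinite play under positional strategies
-- is eventually periodic: if its cycle meets D₀ it ends inside D₀ where σ wins, and otherwise an
-- odd top priority u on the cycle would make μ(·)↾u strictly increase once around the cycle, by
-- the strict regress axiom at u. For the first claim, play a winning strategy of the dominion D₀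
-- on D₀ and the moves offered by the regress measure elsewhere.
module Submission where

open import Defs
open import Level using (Level)
open import Algebra.Properties.CommutativeSemigroup as CommSemigroup using ()
open import Axiom.UniquenessOfIdentityProofs using (module Decidable⇒UIP)
open import Data.Empty using (⊥-elim)
open import Data.Fin using (Fin; toℕ)
open import Data.Fin.Properties using (pigeonhole)
open import Data.List using ([]; _∷_)
open import Data.List.Relation.Unary.All using (_∷_)
open import Data.Nat
  using (ℕ; zero; suc; _+_; _*_; _∸_; _≤_; _<_; _≤′_; ≤′-reflexive; ≤′-step; z≤n; s≤s)
open import Data.Nat.DivMod using (_%_; _/_; m≡m%n+[m/n]*n; m%n<n)
open import Data.Nat.Divisibility using (_∣_; _∣?_)
import Data.Nat.Properties as ℕ
open import Data.Product using (∃-syntax; ∃₂; _×_; _,_; proj₁; proj₂; map₂)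
open import Data.Sum using (inj₁; inj₂)
open import Function using (_∘_)
open import Relation.Binary.PropositionalEquality
  using (_≡_; refl; sym; trans; cong; subst; subst₂; module ≡-Reasoning)
import Relation.Binary.Construct.StrictToNonStrict as StrictToNonStrict
open import Relation.Binary.Structures using (IsStrictTotalOrder)
open import Relation.Nullary using (¬_; yes; no; ¬?)
open import Relation.Nullary.Decidable using (decidable-stable)
open import Relation.Unary using (Decidable)

open CommSemigroup ℕ.+-commutativeSemigroup using (x∙yz≈xz∙y)

segment-induction : ∀ {ℓ} (P : ℕ → Set ℓ) {a b : ℕ} → a ≤ b → P a →
                    (∀ {t} → a ≤ t → t < b → P t → P (suc t)) → P b
segment-induction P {a} a≤b Pa = go (ℕ.≤⇒≤′ a≤b)
  where
  go : ∀ {b} → a ≤′ b → (∀ {t} → a ≤ t → t < b → P t → P (suc t)) → P b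
  go (≤′-reflexive refl) _    = Pa
  go (≤′-step a≤′b)      step =
    step (ℕ.≤′⇒≤ a≤′b) ℕ.≤-refl (go a≤′b (λ a≤t t<b → step a≤t (ℕ.m≤n⇒m≤1+n t<b)))

module _ {ℓ : Level} {A : Set ℓ} {g : ℕ → A} {p : ℕ} (periodic : ∀ d → g (d + suc p) ≡ g d) where
  open ≡-Reasoning

  periodic-iterate : ∀ r m → g (r + m * suc p) ≡ g r
  periodic-iterate r zero    = cong g (ℕ.+-identityʳ r)
  periodic-iterate r (suc m) = begin
    g (r + (suc p + m * suc p)) ≡⟨ cong g (x∙yz≈xz∙y r (suc p) (m * suc p)) ⟩
    g (r + m * suc p + suc p)   ≡⟨ periodic (r + m * suc p) ⟩
    g (r + m * suc p)           ≡⟨ periodic-iterate r m ⟩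
    g r                         ∎

  periodic-residue : ∀ d → ∃[ r ] r ≤ p × g d ≡ g r
  periodic-residue d = d % suc p , ℕ.≤-pred (m%n<n d (suc p)) , (begin
    g d                               ≡⟨ cong g (m≡m%n+[m/n]*n d (suc p)) ⟩
    g (d % suc p + d / suc p * suc p) ≡⟨ periodic-iterate (d % suc p) (d / suc p) ⟩
    g (d % suc p)                     ∎)

module _ {ℓ : Level} {A : Set ℓ} (f : ℕ → A)
         (deterministic : ∀ {a b} → f a ≡ f b → f (suc a) ≡ f (suc b)) where

  deterministic-shift : ∀ {a b} → f a ≡ f b → ∀ d → f (d + a) ≡ f (d + b)
  deterministic-shift fa≡fb zero    = fa≡fb
  deterministic-shift fa≡fb (suc d) = deterministic (deterministic-shift fa≡fb d)

eventually-periodic : ∀ {n} (f : ℕ → Fin n) → (∀ {a b} → f a ≡ f b → f (suc a) ≡ f (suc b)) →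
                      ∃₂ λ i p → ∀ d → f (d + suc p + i) ≡ f (d + i)
eventually-periodic {n} f deterministic
  with i , j , i<j , fi≡fj ← pigeonhole (ℕ.n<1+n n) (f ∘ toℕ)
  with p , 1+i+p≡j ← ℕ.m≤n⇒∃[o]m+o≡n i<j
  = toℕ i , p , λ d → begin
    f (d + suc p + toℕ i)   ≡⟨ cong f (ℕ.+-assoc d (suc p) (toℕ i)) ⟩
    f (d + (suc p + toℕ i)) ≡⟨ cong (λ k → f (d + suc k)) (ℕ.+-comm p (toℕ i)) ⟩
    f (d + suc (toℕ i + p)) ≡⟨ cong (λ k → f (d + k)) 1+i+p≡j ⟩
    f (d + toℕ j)           ≡⟨ deterministic-shift f deterministic fi≡fj d ⟨
    f (d + toℕ i)           ∎
  where open ≡-Reasoning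

module Plays (G : Game) where
  open Game G

  prioUpTo-upper : ∀ (f : ℕ → Pos G) {r k} → r ≤ k → prio (f r) ≤ prioUpTo G f k
  prioUpTo-upper f {k = zero}  z≤n   = ℕ.≤-refl
  prioUpTo-upper f {k = suc k} r≤1+k with ℕ.m≤n⇒m<n∨m≡n r≤1+k
  ... | inj₁ (s≤s r≤k) = ℕ.≤-trans (prioUpTo-upper f r≤k) (ℕ.m≤m⊔n _ _)
  ... | inj₂ refl      = ℕ.m≤n⊔m _ _

  prioUpTo-attained : ∀ (f : ℕ → Pos G) k → ∃[ r ] r ≤ k × prio (f r) ≡ prioUpTo G f k
  prioUpTo-attained f zero    = 0 , z≤n , refl
  prioUpTo-attained f (suc k) with ℕ.⊔-sel (prioUpTo G f k) (prio (f (suc k)))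
  ... | inj₁ max≡left  = let r , r≤k , peak = prioUpTo-attained f k
                         in r , ℕ.m≤n⇒m≤1+n r≤k , trans peak (sym max≡left)
  ... | inj₂ max≡right = suc k , ℕ.≤-refl , sym max≡right

  IsInfPrio-drop : ∀ (f : ℕ → Pos G) k {q} → IsInfPrio G (λ d → f (d + k)) q → IsInfPrio G f q
  IsInfPrio-drop f k {q} (often , maximal) = often′ , maximal′
    where
    often′ : InfOften G f q
    often′ t = let j , t≤j , prio≡q = often t in j + k , ℕ.≤-trans t≤j (ℕ.m≤m+n j k) , prio≡q

    maximal′ : ∀ q′ → InfOften G f q′ → q′ ≤ q
    maximal′ q′ often-f = maximal q′ λ t →
      let j , t+k≤j , prio≡q′ = often-f (t + k)
      in j ∸ k , ℕ.m+n≤o⇒m≤o∸n t t+k≤j ,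
         subst (λ i → prio (f i) ≡ q′) (sym (ℕ.m∸n+n≡m (ℕ.≤-trans (ℕ.m≤n+m k t) t+k≤j))) prio≡q′

  periodic⇒IsInfPrio : ∀ {g : ℕ → Pos G} {p} → (∀ d → g (d + suc p) ≡ g d) →
                       IsInfPrio G g (prioUpTo G g p)
  periodic⇒IsInfPrio {g} {p} periodic = often , maximal
    where
    r₀ : ℕ
    r₀ = proj₁ (prioUpTo-attained g p)

    peak : prio (g r₀) ≡ prioUpTo G g p
    peak = proj₂ (proj₂ (prioUpTo-attained g p))

    often : InfOften G g (prioUpTo G g p)
    often t = r₀ + t * suc p ,
              ℕ.≤-trans (ℕ.m≤m*n t (suc p)) (ℕ.m≤n+m _ r₀) ,
              trans (cong prio (periodic-iterate periodic r₀ t)) peak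

    maximal : ∀ q′ → InfOften G g q′ → q′ ≤ prioUpTo G g p
    maximal q′ often-q′ =
      let j , _ , prio≡q′ = often-q′ 0
          r , r≤p , gj≡gr = periodic-residue periodic j
      in subst (_≤ prioUpTo G g p) (trans (cong prio (sym gj≡gr)) prio≡q′) (prioUpTo-upper g r≤p)

  Prescribed-functional : ∀ {U σ₀ σ₁ x y y′} → U x →
    Prescribed G U σ₀ σ₁ x y → Prescribed G U σ₀ σ₁ x y′ → y ≡ y′
  Prescribed-functional {x = x} {y} {y′} x∈U (p₀ , p₁) (p₀′ , p₁′) = by-owner (owner x) refl
    where
    by-owner : ∀ α → owner x ≡ α → y ≡ y′
    by-owner P0 o = trans (sym (p₀ x∈U o)) (p₀′ x∈U o)
    by-owner P1 o = trans (sym (p₁ x∈U o)) (p₁′ x∈U o)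

  InfinitePlay-eventually-periodic : ∀ {U σ₀ σ₁ v} (π : InfinitePlay G U σ₀ σ₁ v) →
    let open InfinitePlay π in ∃₂ λ i p → ∀ d → pos (d + suc p + i) ≡ pos (d + i)
  InfinitePlay-eventually-periodic {U} {σ₀} {σ₁} π = eventually-periodic pos deterministic
    where
    open InfinitePlay π
    deterministic : ∀ {a b} → pos a ≡ pos b → pos (suc a) ≡ pos (suc b)
    deterministic {a} {b} pa≡pb =
      Prescribed-functional {U} {σ₀} {σ₁} (inU b)
        (subst (λ x → Prescribed G U σ₀ σ₁ x (pos (suc a))) pa≡pb (steps a)) (steps b)

  Ensures-cong : ∀ {U} {σ₀ σ₀′ : Strategy G P0 U} →
                 (∀ v h o → proj₁ (σ₀ v h o) ≡ proj₁ (σ₀′ v h o)) → Ensures G U σ₀′ → Ensures G U σ₀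
  Ensures-cong {U} {σ₀} {σ₀′} same ensures σ₁ v v∈U =
    (λ π → proj₁ (ensures σ₁ v v∈U) (finite π)) , (λ π → proj₂ (ensures σ₁ v v∈U) (infinite π))
    where
    prescribed : ∀ {x y} → Prescribed G U σ₀ σ₁ x y → Prescribed G U σ₀′ σ₁ x y
    prescribed {x} (p₀ , p₁) = (λ h o → trans (sym (same x h o)) (p₀ h o)) , p₁

    finite : FinitePlay G U σ₀ σ₁ v → FinitePlay G U σ₀′ σ₁ v
    finite π = record
      { len = len ; pos = pos ; start = start ; inU = inU
      ; steps = λ i i<len → prescribed (steps i i<len)
      ; stops = map₂ (λ (p , w∉U) → prescribed p , w∉U) stops
      }
      where open FinitePlay π

    infinite : InfinitePlay G U σ₀ σ₁ v → InfinitePlay G U σ₀′ σ₁ v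
    infinite π = record
      { pos = pos ; start = start ; inU = inU ; steps = λ i → prescribed (steps i) }
      where open InfinitePlay π

  override : ∀ {α X} → Decidable X → Strategy G α X → GStrategy G α → GStrategy G α
  override X? τ ρ v o with X? v
  ... | yes v∈X = τ v v∈X o
  ... | no  _   = ρ v o

  override-outside : ∀ {α X} (X? : Decidable X) {τ : Strategy G α X} {ρ v} (o : owner v ≡ α) →
                     ¬ X v → override X? τ ρ v o ≡ ρ v o
  override-outside X? {v = v} o v∉X with X? v
  ... | yes v∈X = ⊥-elim (v∉X v∈X)
  ... | no  _   = refl

  override-inside : ∀ {α X} (X? : Decidable X) {τ : Strategy G α X} {ρ v} (o : owner v ≡ α) →
                    (∀ (h h′ : X v) → h ≡ h′) → (h : X v) → override X? τ ρ v o ≡ τ v h o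
  override-inside X? {τ} {v = v} o irrelevant h with X? v
  ... | yes h′  = cong (λ h → τ v h o) (irrelevant h′ h)
  ... | no  v∉X = ⊥-elim (v∉X h)

  override-prescribed : ∀ {X U} (X? : Decidable X) {σ : GStrategy G P0} {τ : Strategy G P1 X}
    {ρ x y} → X x → Prescribed G X (restrict G X σ) τ x y →
    Prescribed G U (restrict G U σ) (restrict G U (override X? τ ρ)) x y
  override-prescribed X? {τ = τ} {ρ} {x} {y} x∈X (p₀ , p₁) = (λ _ → p₀ x∈X) , λ _ → moves
    where
    moves : ∀ o → proj₁ (override X? τ ρ x o) ≡ y
    moves o with X? x
    ... | yes h   = p₁ h o
    ... | no  x∉X = ⊥-elim (x∉X x∈X)

module SimpleRegressMeasure (G : Game) (𝓜 : MeasureSpace G)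
  (regress : RegressSpace G 𝓜) (canonical : CanonicalTruncation G 𝓜)
  (bot-odd : ∀ v → Odd (Game.prio G v) →
             MeasureSpace._↾_ 𝓜 (MeasureSpace.bot 𝓜) v ≡ MeasureSpace.bot 𝓜)
  (μ : Pos G → MeasureSpace.M 𝓜) (simple : SimpleMeasure G 𝓜 μ) (μ-regress : RegressMeasure G 𝓜 μ)
  where
  open Game G
  open MeasureSpace 𝓜
  open IsStrictTotalOrder isSTO using (_≟_; isEquivalence; <-resp-≈)
    renaming (trans to <ᴹ-trans; irrefl to <ᴹ-irrefl)
  open Plays G
  private module ≤ᴹ = StrictToNonStrict _≡_ _<ᴹ_

  ≤ᴹ-trans : ∀ {x y z} → x ≤ᴹ y → y ≤ᴹ z → x ≤ᴹ z
  ≤ᴹ-trans = ≤ᴹ.trans isEquivalence <-resp-≈ <ᴹ-trans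

  ≤ᴹ-antisym : ∀ {x y} → x ≤ᴹ y → y ≤ᴹ x → x ≡ y
  ≤ᴹ-antisym = ≤ᴹ.antisym isEquivalence <ᴹ-trans <ᴹ-irrefl

  <-≤ᴹ-trans : ∀ {x y z} → x <ᴹ y → y ≤ᴹ z → x <ᴹ z
  <-≤ᴹ-trans = ≤ᴹ.<-≤-trans <ᴹ-trans (proj₁ <-resp-≈)

  ≤ᴹ-<-trans : ∀ {x y z} → x ≤ᴹ y → y <ᴹ z → x <ᴹ z
  ≤ᴹ-<-trans = ≤ᴹ.≤-<-trans sym <ᴹ-trans (proj₂ <-resp-≈)

  ≤ᴹ∧≢⇒<ᴹ : ∀ {x y} → x ≤ᴹ y → ¬ x ≡ y → x <ᴹ y
  ≤ᴹ∧≢⇒<ᴹ (inj₁ x<y) _   = x<y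
  ≤ᴹ∧≢⇒<ᴹ (inj₂ x≡y) x≢y = ⊥-elim (x≢y x≡y)

  ↾-mono : ∀ {η η′} u → η ≤ᴹ η′ → (η ↾ u) ≤ᴹ (η′ ↾ u)
  ↾-mono u η≤η′ = proj₂ canonical _ _ u η≤η′

  D₀ D⊥ D₊ : Region G
  D₀ = D0 G 𝓜 μ
  D⊥ = Dbot G 𝓜 μ
  D₊ = Dplus G 𝓜 μ

  D₀? : Decidable D₀
  D₀? v = μ v ↾ v ≟ top

  D₊? : Decidable D₊
  D₊? v = ¬? (μ v ↾ v ≟ bot)

  D₀-irrelevant : ∀ {v} (h h′ : D₀ v) → h ≡ h′
  D₀-irrelevant = Decidable⇒UIP.≡-irrelevant _≟_

  D₀∖D₊⇒top≡bot : ∀ {v} → D₀ v → ¬ D₊ v → top ≡ bot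
  D₀∖D₊⇒top≡bot v∈D₀ v∉D₊ = trans (sym v∈D₀) (decidable-stable (μ _ ↾ _ ≟ bot) v∉D₊)

  top≡bot⇒¬D₊ : top ≡ bot → ∀ {v} → ¬ D₊ v
  top≡bot⇒¬D₊ top≡bot v∈D₊ = v∈D₊ (≤ᴹ-antisym (subst (_ ≤ᴹ_) top≡bot (top-max _)) (bot-min _))

  ¬D₊⇒μ≡bot : ∀ {v} → ¬ D₊ v → μ v ≡ bot
  ¬D₊⇒μ≡bot {v} v∉D₊ with simple v
  ... | inj₁ μv≡top = ≤ᴹ-antisym (subst (μ v ≤ᴹ_) top≡bot (top-max _)) (bot-min _)
    where top≡bot = D₀∖D₊⇒top≡bot (proj₁ (proj₁ canonical (μ v) v) μv≡top) v∉D₊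
  ... | inj₂ ([]    , _ , _ , _ , _ , msr≡μv) = sym msr≡μv
  ... | inj₂ (_ ∷ _ , refl , _ , _ , v∈D₊ ∷ _ , _) = ⊥-elim (v∉D₊ v∈D₊)

  regressStrategy : GStrategy G P0
  regressStrategy v o with D₊? v | D₀? v
  ... | yes v∈D₊ | no v∉D₀ = map₂ proj₁ (proj₁ (μ-regress v v∈D₊ v∉D₀) o)
  ... | _        | _       = total v

  regressStrategy-coherent : ∀ v (o : owner v ≡ P0) → D₊ v → ¬ D₀ v →
                             μ v ≤ᴹ (μ (proj₁ (regressStrategy v o)) ⊕ v)
  regressStrategy-coherent v o v∈D₊ v∉D₀ with D₊? v | D₀? v
  ... | yes v∈D₊′ | no v∉D₀′ = proj₂ (proj₂ (proj₁ (μ-regress v v∈D₊′ v∉D₀′) o))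
  ... | no v∉D₊   | _        = ⊥-elim (v∉D₊ v∈D₊)
  ... | yes _     | yes v∈D₀ = ⊥-elim (v∉D₀ v∈D₀)

  -- On D₀ the strategy built for the first claim follows the dominion strategy, which need not be
  -- coherent there.
  CoherentOffD₀ : GStrategy G P0 → Set
  CoherentOffD₀ σ =
    ∀ v (o : owner v ≡ P0) → D₊ v → ¬ D₀ v → μ v ≤ᴹ (μ (proj₁ (σ v o)) ⊕ v)

  module _ (σ : GStrategy G P0) (coherent : CoherentOffD₀ σ) (wins : WinningOn G D₀ σ) where
    module _ (σ₁ : Strategy G P1 D₊) where

      _⇝_ : Pos G → Pos G → Set
      x ⇝ y = Prescribed G D₊ (restrict G D₊ σ) σ₁ x y

      Segment : (ℕ → Pos G) → ℕ → ℕ → Set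
      Segment f a b = ∀ {t} → a ≤ t → t < b → D₊ (f t) × f t ⇝ f (suc t)

      Run : (ℕ → Pos G) → Set
      Run f = ∀ t → D₊ (f t) × f t ⇝ f (suc t)

      -- σ₁ only matters on D₊, so any move will do outside it.
      σ₁↑ : Strategy G P1 D₀
      σ₁↑ = restrict G D₀ (override D₊? σ₁ (λ v _ → total v))

      regress-step : ∀ {x y} → D₊ x → ¬ D₀ x → x ⇝ y → μ x ≤ᴹ (μ y ⊕ x)
      regress-step {x} {y} x∈D₊ x∉D₀ (p₀ , p₁) = by-owner (owner x) refl
        where
        by-owner : ∀ α → owner x ≡ α → μ x ≤ᴹ (μ y ⊕ x)
        by-owner P0 o = subst (λ z → μ x ≤ᴹ (μ z ⊕ x)) (p₀ x∈D₊ o) (coherent x o x∈D₊ x∉D₀)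
        by-owner P1 o =
          proj₂ (μ-regress x x∈D₊ x∉D₀) o y (subst (E x) (p₁ x∈D₊ o) (proj₂ (σ₁ x x∈D₊ o)))

      ↾-step : ∀ {x y u} → Odd (prio u) → prio x ≤ prio u → D₊ x → ¬ D₀ x → x ⇝ y →
               (μ x ↾ u) ≤ᴹ (μ y ↾ u)
      ↾-step {x} {y} {u} odd x≤u x∈D₊ x∉D₀ x⇝y =
        ≤ᴹ-trans (↾-mono u (regress-step x∈D₊ x∉D₀ x⇝y)) (proj₂ regress (μ y) x u odd x≤u)

      ↾-step-strict : ∀ {x y} → Odd (prio x) → D₊ x → ¬ D₀ x → ¬ D₀ y → x ⇝ y →
                      (μ x ↾ x) <ᴹ (μ y ↾ x)
      ↾-step-strict {x} {y} odd x∈D₊ x∉D₀ y∉D₀ x⇝y =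
        ≤ᴹ-<-trans stretch (proj₁ regress (μ y) x bot<μy↾x μy↾x<top odd)
        where
        stretch : (μ x ↾ x) ≤ᴹ ((μ y ⊕ x) ↾ x)
        stretch = ↾-mono x (regress-step x∈D₊ x∉D₀ x⇝y)

        bot<μy↾x : bot <ᴹ (μ y ↾ x)
        bot<μy↾x = <-≤ᴹ-trans (≤ᴹ∧≢⇒<ᴹ (bot-min _) (x∈D₊ ∘ sym))
                              (≤ᴹ-trans stretch (proj₂ regress (μ y) x x odd ℕ.≤-refl))

        μy↾x<top : (μ y ↾ x) <ᴹ top
        μy↾x<top = ≤ᴹ∧≢⇒<ᴹ (top-max _)
          (y∉D₀ ∘ proj₁ (proj₁ canonical (μ y) y) ∘ proj₂ (proj₁ canonical (μ y) x))

      D₀-step : ∀ {x y} → D₀ x → D₊ x → x ⇝ y → D₀ y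
      D₀-step {x} {y} x∈D₀ x∈D₊ x⇝y with D₀? y
      ... | yes y∈D₀ = y∈D₀
      ... | no  y∉D₀ = ⊥-elim (proj₁ (wins σ₁↑ x x∈D₀) leaving)
        where
        leaving : FinitePlay G D₀ (restrict G D₀ σ) σ₁↑ x
        leaving = record
          { len = 0 ; pos = λ _ → x ; start = refl ; inU = λ _ _ → x∈D₀ ; steps = λ _ ()
          ; stops = y , override-prescribed {U = D₀} D₊? {σ} x∈D₊ x⇝y , y∉D₀ }

      D₀-forward : ∀ {f a b} → a ≤ b → Segment f a b → D₀ (f a) → D₀ (f b)
      D₀-forward {f} a≤b segment fa∈D₀ = segment-induction (D₀ ∘ f) a≤b fa∈D₀
        λ a≤t t<b ft∈D₀ → let ft∈D₊ , step = segment a≤t t<b in D₀-step ft∈D₀ ft∈D₊ step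

      ↾-nondecreasing : ∀ {f a b u} → Odd (prio u) → a ≤ b → Segment f a b →
        (∀ {t} → a ≤ t → t < b → ¬ D₀ (f t) × prio (f t) ≤ prio u) →
        (μ (f a) ↾ u) ≤ᴹ (μ (f b) ↾ u)
      ↾-nondecreasing {f} {a} {u = u} odd a≤b segment below =
        segment-induction (λ t → (μ (f a) ↾ u) ≤ᴹ (μ (f t) ↾ u)) a≤b (inj₂ refl)
          λ a≤t t<b fa≤ft →
          let ft∈D₊ , step = segment a≤t t<b ; ft∉D₀ , ft≤u = below a≤t t<b
          in ≤ᴹ-trans fa≤ft (↾-step odd ft≤u ft∈D₊ ft∉D₀ step)

      D₀-run-even : ∀ {f} → Run f → D₀ (f 0) → ∃[ q ] IsInfPrio G f q × Even q
      D₀-run-even {f} run f0∈D₀ = proj₂ (wins σ₁↑ (f 0) f0∈D₀) play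
        where
        play : InfinitePlay G D₀ (restrict G D₀ σ) σ₁↑ (f 0)
        play = record
          { pos = f ; start = refl
          ; inU = λ t → D₀-forward z≤n (λ {s} _ _ → run s) f0∈D₀
          ; steps = λ t → override-prescribed {U = D₀} D₊? {σ} (proj₁ (run t)) (proj₂ (run t)) }

      D₀-free-cycle-even : ∀ {g p} → Run g → (∀ d → g (d + suc p) ≡ g d) → (∀ d → ¬ D₀ (g d)) →
                           Even (prioUpTo G g p)
      D₀-free-cycle-even {g} {p} run periodic avoids with 2 ∣? prioUpTo G g p
      ... | yes even = even
      ... | no  odd  = ⊥-elim (<ᴹ-irrefl refl (<-≤ᴹ-trans first around))
        where
        r₀ : ℕ
        r₀ = proj₁ (prioUpTo-attained g p)

        u : Pos G
        u = g r₀

        peak : prio u ≡ prioUpTo G g p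
        peak = proj₂ (proj₂ (prioUpTo-attained g p))

        odd-u : Odd (prio u)
        odd-u = odd ∘ subst (2 ∣_) peak

        bounded : ∀ d → prio (g d) ≤ prio u
        bounded d = let r , r≤p , gd≡gr = periodic-residue periodic d
                    in subst₂ _≤_ (cong prio (sym gd≡gr)) (sym peak) (prioUpTo-upper g r≤p)

        first : (μ u ↾ u) <ᴹ (μ (g (suc r₀)) ↾ u)
        first = ↾-step-strict odd-u (proj₁ (run r₀)) (avoids r₀) (avoids (suc r₀)) (proj₂ (run r₀))

        rest : (μ (g (suc r₀)) ↾ u) ≤ᴹ (μ (g (r₀ + suc p)) ↾ u)
        rest = ↾-nondecreasing odd-u (ℕ.m<m+n r₀ (s≤s z≤n))
                 (λ {t} _ _ → run t) (λ {t} _ _ → avoids t , bounded t)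

        around : (μ (g (suc r₀)) ↾ u) ≤ᴹ (μ u ↾ u)
        around = subst (λ z → (μ (g (suc r₀)) ↾ u) ≤ᴹ (μ z ↾ u)) (periodic r₀) rest

      periodic-run-even : ∀ {g p} → Run g → (∀ d → g (d + suc p) ≡ g d) →
                          ∃[ q ] IsInfPrio G g q × Even q
      periodic-run-even {g} {p} run periodic with ℕ.anyUpTo? (D₀? ∘ g) (suc p)
      ... | yes (r , _ , gr∈D₀) =
        let q , infPrio , even = D₀-run-even (λ t → run (t + r)) gr∈D₀
        in q , IsInfPrio-drop g r infPrio , even
      ... | no  no-D₀ =
        prioUpTo G g p , periodic⇒IsInfPrio periodic , D₀-free-cycle-even run periodic avoids
        where
        avoids : ∀ d → ¬ D₀ (g d)
        avoids d gd∈D₀ = let r , r≤p , gd≡gr = periodic-residue periodic d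
                         in no-D₀ (r , s≤s r≤p , subst D₀ gd≡gr gd∈D₀)

      infinitePlay-even : ∀ {v} (π : InfinitePlay G D₊ (restrict G D₊ σ) σ₁ v) → InfEven G π
      infinitePlay-even π =
        let i , p , periodic = InfinitePlay-eventually-periodic π
            q , infPrio , even = periodic-run-even (λ t → inU (t + i) , steps (t + i)) periodic
        in q , IsInfPrio-drop pos i infPrio , even
        where open InfinitePlay π

      finitePlay-even : ∀ {v} (π : FinitePlay G D₊ (restrict G D₊ σ) σ₁ v) → Even (FinPrio G π)
      finitePlay-even π with 2 ∣? FinPrio G π
      ... | yes even = even
      ... | no  odd  = ⊥-elim (inU r₀ r₀≤len u∈D⊥)
        where
        open FinitePlay π
        w : Pos G
        w = proj₁ stops

        len⇝w : pos len ⇝ w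
        len⇝w = proj₁ (proj₂ stops)

        w∉D₊ : ¬ D₊ w
        w∉D₊ = proj₂ (proj₂ stops)

        segment : ∀ {a} → Segment pos a len
        segment {t = t} _ t<len = inU t (ℕ.<⇒≤ t<len) , steps t t<len

        avoids : ∀ {t} → t ≤ len → ¬ D₀ (pos t)
        avoids t≤len pt∈D₀ =
          let w∈D₀ = D₀-step (D₀-forward t≤len segment pt∈D₀) (inU len ℕ.≤-refl) len⇝w
          in top≡bot⇒¬D₊ (D₀∖D₊⇒top≡bot w∈D₀ w∉D₊) (inU 0 z≤n)

        r₀ : ℕ
        r₀ = proj₁ (prioUpTo-attained pos len)

        r₀≤len : r₀ ≤ len
        r₀≤len = proj₁ (proj₂ (prioUpTo-attained pos len))

        u : Pos G
        u = pos r₀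

        peak : prio u ≡ prioUpTo G pos len
        peak = proj₂ (proj₂ (prioUpTo-attained pos len))

        odd-u : Odd (prio u)
        odd-u = odd ∘ subst (2 ∣_) peak

        bounded : ∀ {t} → t ≤ len → prio (pos t) ≤ prio u
        bounded t≤len = subst (prio (pos _) ≤_) (sym peak) (prioUpTo-upper pos t≤len)

        climb : (μ u ↾ u) ≤ᴹ (μ (pos len) ↾ u)
        climb = ↾-nondecreasing odd-u r₀≤len segment
          (λ _ t<len → avoids (ℕ.<⇒≤ t<len) , bounded (ℕ.<⇒≤ t<len))

        exit : (μ (pos len) ↾ u) ≤ᴹ (μ w ↾ u)
        exit = ↾-step odd-u (bounded ℕ.≤-refl) (inU len ℕ.≤-refl) (avoids ℕ.≤-refl) len⇝w

        μw↾u≡bot : (μ w ↾ u) ≡ bot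
        μw↾u≡bot = trans (cong (_↾ u) (¬D₊⇒μ≡bot w∉D₊)) (bot-odd u odd-u)

        u∈D⊥ : D⊥ u
        u∈D⊥ = ≤ᴹ-antisym (subst ((μ u ↾ u) ≤ᴹ_) μw↾u≡bot (≤ᴹ-trans climb exit)) (bot-min _)

    coherent-winning⇒quasiWitness : QuasiWitness G D₊ (restrict G D₊ σ)
    coherent-winning⇒quasiWitness σ₁ _ _ = finitePlay-even σ₁ , infinitePlay-even σ₁

  module _ (τ : Strategy G P0 D₀) (τ-wins : Ensures G D₀ τ) where

    dominionRegressStrategy : GStrategy G P0
    dominionRegressStrategy = override D₀? τ regressStrategy

    dominionRegressStrategy-coherent : CoherentOffD₀ dominionRegressStrategy
    dominionRegressStrategy-coherent v o v∈D₊ v∉D₀ =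
      subst (λ m → μ v ≤ᴹ (μ (proj₁ m) ⊕ v)) (sym (override-outside D₀? o v∉D₀))
        (regressStrategy-coherent v o v∈D₊ v∉D₀)

    dominionRegressStrategy-wins : WinningOn G D₀ dominionRegressStrategy
    dominionRegressStrategy-wins =
      Ensures-cong (λ v h o → cong proj₁ (override-inside D₀? o D₀-irrelevant h)) τ-wins

theorem19 : (G : Game) (𝓜 : MeasureSpace G) →
    RegressSpace G 𝓜 → CanonicalTruncation G 𝓜 →
    (∀ v → Odd (Game.prio G v) → MeasureSpace._↾_ 𝓜 (MeasureSpace.bot 𝓜) v ≡ MeasureSpace.bot 𝓜) →
    (μ : Pos G → MeasureSpace.M 𝓜) →
    SimpleMeasure G 𝓜 μ → QuasiDominionMeasure G 𝓜 μ →
    QuasiDominion0 G (Dplus G 𝓜 μ) ×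
    (∀ (σ : GStrategy G P0) → Coherent G 𝓜 μ σ → WinningOn G (D0 G 𝓜 μ) σ →
    QuasiWitness G (Dplus G 𝓜 μ) (restrict G (Dplus G 𝓜 μ) σ))
theorem19 G 𝓜 regress canonical bot-odd μ simple (μ-regress , τ , τ-wins) =
  (restrict G D₊ σ* , coherent-winning⇒quasiWitness σ* σ*-coherent σ*-wins) ,
  λ σ coherent wins → coherent-winning⇒quasiWitness σ (λ v o _ _ → coherent v o) wins
  where
  open SimpleRegressMeasure G 𝓜 regress canonical bot-odd μ simple μ-regress

  σ* : GStrategy G P0
  σ* = dominionRegressStrategy τ τ-wins

  σ*-coherent : CoherentOffD₀ σ*
  σ*-coherent = dominionRegressStrategy-coherent τ τ-wins

  σ*-wins : WinningOn G D₀ σ*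
  σ*-wins = dominionRegressStrategy-wins τ τ-wins
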